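{- Let $k\ge1$, let $H$ be a $2k$-meager hypergraph, let $Y$ be a vertex set of cardinality $\leq k$, and let $p=\|\overline{Y}\setminus Y\|$. Then $p<k$, and there is an ordering $z_1,\dots,z_p$ of $\overline{Y}\setminus Y$ such that each $z_j$ is attracted by $Y\cup\{z_i : i<j\}$.
   Context: A hypergraph is a pair $H=(U,T)$ with $U$ a finite nonempty vertex set and $T$ a collection of 3-element subsets of $U$ (hyperedges). For nonempty $X\subseteq U$, $\|X\|$ is its cardinality and $[X]$ the number of hyperedges contained in $X$; $X$ is dense if $\|X\|\le2[X]$; $H$ is $l$-meager if it has no dense vertex sets of cardinality $\le 2l$. A vertex set $X$ attracts a vertex $y$ if there are $x_1,x_2\in X$ with $\{x_1,x_2,y\}\in T$. $X$ is closed if it contains every vertex it attracts; the closure $\overline{X}$ is the least closed set containing $X$. -}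

module Defs where

open import Data.Nat using (ℕ; zero; suc; _≤_; _<_; _*_; NonZero)
open import Data.Bool using (Bool; true; false; _∧_; not; if_then_else_)
open import Data.Fin using (Fin)
open import Data.Fin.Subset using (Subset; inside; outside; _∈_; _∉_; _⊆_; _∪_; _─_; ⁅_⁆; ∣_∣; Nonempty)
open import Data.Vec using (_∷_; [])
open import Data.List using (List; []; _∷_; map; _++_; length; filter)
open import Data.Product using (Σ; ∃; _×_)
open import Relation.Binary.PropositionalEquality using (_≡_)
open import Relation.Nullary using (¬_)
open import Relation.Nullary.Decidable using (Dec; _because_; yes; no)
open import Data.Bool.Properties using (T?)

record Hypergraph : Set where
  field
    n        : ℕ
    nonempty : NonZero n
    edge     : Subset n → Bool
    edge-3   : ∀ S → edge S ≡ true → ∣ S ∣ ≡ 3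

open Hypergraph public

allSubsets : (m : ℕ) → List (Subset m)
allSubsets zero    = [] ∷ []
allSubsets (suc m) = map (inside ∷_) (allSubsets m) ++ map (outside ∷_) (allSubsets m)

isSub : ∀ {m} → Subset m → Subset m → Bool
isSub []            []            = true
isSub (inside ∷ p)  (inside ∷ q)  = isSub p q
isSub (inside ∷ p)  (outside ∷ q) = false
isSub (outside ∷ p) (_ ∷ q)       = isSub p q

module _ (H : Hypergraph) where

  edgesIn : Subset (n H) → ℕ
  edgesIn X = length (filter (λ S → T? (edge H S ∧ isSub S X)) (allSubsets (n H)))

  Dense : Subset (n H) → Set
  Dense X = Nonempty X × ∣ X ∣ ≤ 2 * edgesIn X

  Meager : ℕ → Set
  Meager l = ∀ (X : Subset (n H)) → ∣ X ∣ ≤ 2 * l → ¬ Dense X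

  AttractsP : (Fin (n H) → Set) → Fin (n H) → Set
  AttractsP P y = Σ (Fin (n H)) λ x₁ → Σ (Fin (n H)) λ x₂ →
    P x₁ × P x₂ × edge H (⁅ x₁ ⁆ ∪ ⁅ x₂ ⁆ ∪ ⁅ y ⁆) ≡ true

  Attracts : Subset (n H) → Fin (n H) → Set
  Attracts X = AttractsP (_∈ X)

  Closed : Subset (n H) → Set
  Closed X = ∀ y → Attracts X y → y ∈ X

  IsClosure : Subset (n H) → Subset (n H) → Set
  IsClosure X C = X ⊆ C × Closed C × (∀ D → X ⊆ D → Closed D → C ⊆ D)

module Submission where

-- Enumerate C ─ Y greedily: as long as Y ∪ D is not closed, append to D a vertex it
-- attracts. The hyperedge that attracts the new vertex was not inside the old Y ∪ D,
-- so after m steps Y ∪ D contains at least m hyperedges. Were k steps possible,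
-- Y ∪ D would have at most 2k vertices and at least k hyperedges, i.e. be dense,
-- which meagerness forbids. Hence the process stops after p < k steps at a closed
-- set between Y and C, which must be C itself, so D = C ─ Y.

open import Defs
open import Data.Nat using (ℕ; _≤_; _<_; _*_; zero; suc; _+_; z≤n; s≤s)
open import Data.Nat.Properties
import Data.Fin as Fin
open import Data.Fin using (Fin; toℕ; fromℕ; fromℕ<; inject₁) renaming (_<_ to _<ᶠ_)
open import Data.Fin.Properties using (any?; toℕ-inject₁; toℕ-fromℕ; inject₁ℕ<)
open import Data.Fin.Relation.Unary.Top using (view; ‵fromℕ; ‵inject₁)
open import Data.Fin.Subset
  using (Subset; _∈_; _∉_; _─_; ∣_∣; _∪_; ⁅_⁆; ⊥; _⊆_; inside; outside; Nonempty)
open import Data.Fin.Subset.Properties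
  using (_∈?_; ∉⊥; ∣⊥∣≡0; x∈⁅x⁆; x∈⁅y⁆⇒x≡y; ⊆-antisym; p⊆p∪q; q⊆p∪q; x∈p∪q⁻;
         x∈p∧x∉q⇒x∈p─q; p─q⊆p; ∪-identityʳ; ∪-assoc; drop-∷-⊆)
open import Data.Vec using (_∷_; []; here; there)
open import Data.Vec.Functional using (insertAt)
open import Data.Vec.Functional.Properties using (insertAt-lookup)
open import Data.Bool using (T; true; _∧_)
open import Data.Bool.Properties using (T?; T-∧; T-≡) renaming (_≟_ to _≟ᵇ_)
open import Data.List using ([]; _∷_; filter; length; map)
import Data.List.Membership.Propositional as List
open import Data.List.Membership.Propositional.Properties using (∈-++⁺ˡ; ∈-++⁺ʳ; ∈-map⁺)
open import Data.List.Relation.Unary.Any using (here; there)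
open import Data.Product using (Σ; ∃; _×_; _,_; proj₁; proj₂)
open import Data.Sum using (_⊎_; inj₁; inj₂)
open import Function using (_∘_; Equivalence)
open import Function.Definitions using (Injective)
open import Relation.Nullary using (¬_; yes; no; contradiction)
open import Relation.Nullary.Decidable using (Dec; ¬?; _×-dec_; decidable-stable)
open import Relation.Unary using (Pred; Decidable)
open import Relation.Binary.PropositionalEquality using (_≡_; _≢_; refl; sym; trans; cong; subst; subst₂)

module _ {a ℓ₁ ℓ₂} {A : Set a} {P : Pred A ℓ₁} {Q : Pred A ℓ₂}
         (P? : Decidable P) (Q? : Decidable Q) (P⇒Q : ∀ {x} → P x → Q x) where

  length-filter-≤ : ∀ xs → length (filter P? xs) ≤ length (filter Q? xs)
  length-filter-≤ [] = z≤n
  length-filter-≤ (x ∷ xs) with P? x | Q? x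
  ... | yes _ | yes _  = s≤s (length-filter-≤ xs)
  ... | yes p | no ¬q  = contradiction (P⇒Q p) ¬q
  ... | no _  | yes _  = m≤n⇒m≤1+n (length-filter-≤ xs)
  ... | no _  | no _   = length-filter-≤ xs

  length-filter-< : ∀ {y} xs → y List.∈ xs → ¬ P y → Q y →
                    length (filter P? xs) < length (filter Q? xs)
  length-filter-< (x ∷ xs) (here refl) ¬p q with P? x | Q? x
  ... | yes p | _     = contradiction p ¬p
  ... | no _  | yes _ = s≤s (length-filter-≤ xs)
  ... | no _  | no ¬q = contradiction q ¬q
  length-filter-< (x ∷ xs) (there y∈xs) ¬p q with P? x | Q? x
  ... | yes _ | yes _  = s≤s (length-filter-< xs y∈xs ¬p q)
  ... | yes p | no ¬q  = contradiction (P⇒Q p) ¬q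
  ... | no _  | yes _  = m<n⇒m<1+n (length-filter-< xs y∈xs ¬p q)
  ... | no _  | no _   = length-filter-< xs y∈xs ¬p q

isSub⇒⊆ : ∀ {m} {S X : Subset m} → T (isSub S X) → S ⊆ X
isSub⇒⊆ {S = inside ∷ S}  {inside ∷ X} s here       = here
isSub⇒⊆ {S = inside ∷ S}  {inside ∷ X} s (there x) = there (isSub⇒⊆ s x)
isSub⇒⊆ {S = outside ∷ S} {_ ∷ X}      s (there x) = there (isSub⇒⊆ s x)

⊆⇒isSub : ∀ {m} {S X : Subset m} → S ⊆ X → T (isSub S X)
⊆⇒isSub {S = []}          {[]}          S⊆X = _
⊆⇒isSub {S = inside ∷ S}  {inside ∷ X}  S⊆X = ⊆⇒isSub (drop-∷-⊆ S⊆X)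
⊆⇒isSub {S = inside ∷ S}  {outside ∷ X} S⊆X with () ← S⊆X here
⊆⇒isSub {S = outside ∷ S} {_ ∷ X}       S⊆X = ⊆⇒isSub (drop-∷-⊆ S⊆X)

∈-allSubsets : ∀ {m} (S : Subset m) → S List.∈ allSubsets m
∈-allSubsets []            = here refl
∈-allSubsets (inside ∷ S)  = ∈-++⁺ˡ (∈-map⁺ (inside ∷_) (∈-allSubsets S))
∈-allSubsets (outside ∷ S) =
  ∈-++⁺ʳ (map (inside ∷_) (allSubsets _)) (∈-map⁺ (outside ∷_) (∈-allSubsets S))

x∈p─q⇒x∉q : ∀ {m} {p q : Subset m} {x} → x ∈ p ─ q → x ∉ q
x∈p─q⇒x∉q {p = _ ∷ p} {inside ∷ q} ()        here
x∈p─q⇒x∉q {p = _ ∷ p} {_ ∷ q}      (there x) (there x′) = x∈p─q⇒x∉q x x′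

∣p∪q∣≤∣p∣+∣q∣ : ∀ {m} (p q : Subset m) → ∣ p ∪ q ∣ ≤ ∣ p ∣ + ∣ q ∣
∣p∪q∣≤∣p∣+∣q∣ []            []            = z≤n
∣p∪q∣≤∣p∣+∣q∣ (inside ∷ p)  (inside ∷ q)  =
  s≤s (≤-trans (∣p∪q∣≤∣p∣+∣q∣ p q) (+-monoʳ-≤ ∣ p ∣ (n≤1+n ∣ q ∣)))
∣p∪q∣≤∣p∣+∣q∣ (inside ∷ p)  (outside ∷ q) = s≤s (∣p∪q∣≤∣p∣+∣q∣ p q)
∣p∪q∣≤∣p∣+∣q∣ (outside ∷ p) (inside ∷ q)  =
  ≤-trans (s≤s (∣p∪q∣≤∣p∣+∣q∣ p q)) (≤-reflexive (sym (+-suc ∣ p ∣ ∣ q ∣)))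
∣p∪q∣≤∣p∣+∣q∣ (outside ∷ p) (outside ∷ q) = ∣p∪q∣≤∣p∣+∣q∣ p q

x∉p⇒∣p∪⁅x⁆∣≡1+∣p∣ : ∀ {m} {p : Subset m} {x} → x ∉ p → ∣ p ∪ ⁅ x ⁆ ∣ ≡ suc ∣ p ∣
x∉p⇒∣p∪⁅x⁆∣≡1+∣p∣ {p = inside ∷ p}  {Fin.zero}  x∉p = contradiction here x∉p
x∉p⇒∣p∪⁅x⁆∣≡1+∣p∣ {p = outside ∷ p} {Fin.zero}  x∉p = cong (suc ∘ ∣_∣) (∪-identityʳ p)
x∉p⇒∣p∪⁅x⁆∣≡1+∣p∣ {p = inside ∷ p}  {Fin.suc x} x∉p = cong suc (x∉p⇒∣p∪⁅x⁆∣≡1+∣p∣ (x∉p ∘ there))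
x∉p⇒∣p∪⁅x⁆∣≡1+∣p∣ {p = outside ∷ p} {Fin.suc x} x∉p = x∉p⇒∣p∪⁅x⁆∣≡1+∣p∣ (x∉p ∘ there)

inject₁-mono-< : ∀ {m} {i j : Fin m} → i <ᶠ j → inject₁ i <ᶠ inject₁ j
inject₁-mono-< {i = i} {j} = subst₂ _<_ (sym (toℕ-inject₁ i)) (sym (toℕ-inject₁ j))

inject₁<fromℕ : ∀ {m} (i : Fin m) → inject₁ i <ᶠ fromℕ m
inject₁<fromℕ {m} i = subst (toℕ (inject₁ i) <_) (sym (toℕ-fromℕ m)) (inject₁ℕ< i)

insertAt-fromℕ-inject₁ : ∀ {A : Set} {m} (xs : Fin m → A) (v : A) (i : Fin m) →
  insertAt xs (fromℕ m) v (inject₁ i) ≡ xs i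
insertAt-fromℕ-inject₁ {m = suc m} xs v Fin.zero    = refl
insertAt-fromℕ-inject₁ {m = suc m} xs v (Fin.suc i) = insertAt-fromℕ-inject₁ (xs ∘ Fin.suc) v i

module _ (H : Hypergraph) where

  private
    V = Fin (n H)

  AttractsP-mono : {P Q : V → Set} → (∀ {v} → P v → Q v) →
                   ∀ {y} → AttractsP H P y → AttractsP H Q y
  AttractsP-mono P⇒Q (x₁ , x₂ , p₁ , p₂ , e) = x₁ , x₂ , P⇒Q p₁ , P⇒Q p₂ , e

  triangle⊆ : ∀ {x₁ x₂ y} {Z : Subset (n H)} → x₁ ∈ Z → x₂ ∈ Z → y ∈ Z →
              ⁅ x₁ ⁆ ∪ ⁅ x₂ ⁆ ∪ ⁅ y ⁆ ⊆ Z
  triangle⊆ {x₁} {x₂} {y} x₁∈Z x₂∈Z y∈Z v∈S with x∈p∪q⁻ ⁅ x₁ ⁆ (⁅ x₂ ⁆ ∪ ⁅ y ⁆) v∈S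
  ... | inj₁ v∈x₁ rewrite x∈⁅y⁆⇒x≡y x₁ v∈x₁ = x₁∈Z
  ... | inj₂ v∈x₂y with x∈p∪q⁻ ⁅ x₂ ⁆ ⁅ y ⁆ v∈x₂y
  ...   | inj₁ v∈x₂ rewrite x∈⁅y⁆⇒x≡y x₂ v∈x₂ = x₂∈Z
  ...   | inj₂ v∈y  rewrite x∈⁅y⁆⇒x≡y y v∈y = y∈Z

  edge∧isSub⁺ : ∀ {S X} → edge H S ≡ true → S ⊆ X → T (edge H S ∧ isSub S X)
  edge∧isSub⁺ {S} {X} e S⊆X =
    Equivalence.from (T-∧ {edge H S} {isSub S X}) (Equivalence.from T-≡ e , ⊆⇒isSub S⊆X)

  edge∧isSub⁻ : ∀ {S X} → T (edge H S ∧ isSub S X) → edge H S ≡ true × S ⊆ X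
  edge∧isSub⁻ {S} {X} t with Equivalence.to (T-∧ {edge H S} {isSub S X}) t
  ... | e , s = Equivalence.to T-≡ e , isSub⇒⊆ s

  edgesIn-< : ∀ {X X′ S} → X ⊆ X′ → edge H S ≡ true → S ⊆ X′ → ¬ S ⊆ X →
              edgesIn H X < edgesIn H X′
  edgesIn-< {X} {X′} {S} X⊆X′ S-edge S⊆X′ S⊈X =
    length-filter-< (λ S → T? (edge H S ∧ isSub S X)) (λ S → T? (edge H S ∧ isSub S X′)) widen
      (allSubsets (n H)) (∈-allSubsets S) (S⊈X ∘ proj₂ ∘ edge∧isSub⁻) (edge∧isSub⁺ S-edge S⊆X′)
    where
    widen : ∀ {S} → T (edge H S ∧ isSub S X) → T (edge H S ∧ isSub S X′)
    widen t with edge∧isSub⁻ t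
    ... | e , S⊆X = edge∧isSub⁺ e (X⊆X′ ∘ S⊆X)

  edgesIn-<-∪⁅⁆ : ∀ {X y} → y ∉ X → Attracts H X y → edgesIn H X < edgesIn H (X ∪ ⁅ y ⁆)
  edgesIn-<-∪⁅⁆ {X} {y} y∉X (x₁ , x₂ , x₁∈X , x₂∈X , e) =
    edgesIn-< (p⊆p∪q ⁅ y ⁆) e
      (triangle⊆ (p⊆p∪q ⁅ y ⁆ x₁∈X) (p⊆p∪q ⁅ y ⁆ x₂∈X) (q⊆p∪q X ⁅ y ⁆ (x∈⁅x⁆ y)))
      (λ S⊆X → y∉X (S⊆X (q⊆p∪q ⁅ x₁ ⁆ _ (q⊆p∪q ⁅ x₂ ⁆ ⁅ y ⁆ (x∈⁅x⁆ y)))))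

  attracts? : ∀ X y → Dec (Attracts H X y)
  attracts? X y = any? λ x₁ → any? λ x₂ →
    x₁ ∈? X ×-dec x₂ ∈? X ×-dec edge H (⁅ x₁ ⁆ ∪ ⁅ x₂ ⁆ ∪ ⁅ y ⁆) ≟ᵇ true

  closed⊎attractsOutside : ∀ X → Closed H X ⊎ ∃ λ y → y ∉ X × Attracts H X y
  closed⊎attractsOutside X with any? (λ y → ¬? (y ∈? X) ×-dec attracts? X y)
  ... | yes escapee = inj₂ escapee
  ... | no ¬escapee =
    inj₁ λ y att → decidable-stable (y ∈? X) (λ y∉X → ¬escapee (y , y∉X , att))

  AttractionOrdering : Subset (n H) → Subset (n H) → ℕ → Set
  AttractionOrdering Y D m =
    Σ (Fin m → V) λ z →
      Injective _≡_ _≡_ z ×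
      (∀ v → v ∈ D → ∃ λ j → z j ≡ v) ×
      (∀ j → z j ∈ D) ×
      (∀ j → AttractsP H (λ v → v ∈ Y ⊎ ∃ λ i → i <ᶠ j × z i ≡ v) (z j))

  emptyOrdering : ∀ {Y} → AttractionOrdering Y ⊥ 0
  emptyOrdering = (λ ()) , (λ { {()} }) , (λ v v∈⊥ → contradiction v∈⊥ ∉⊥) , (λ ()) , (λ ())

  extendOrdering : ∀ {Y D m y} → AttractionOrdering Y D m → y ∉ D → Attracts H (Y ∪ D) y →
    AttractionOrdering Y (D ∪ ⁅ y ⁆) (suc m)
  extendOrdering {Y} {D} {m} {y} (z , z-inj , z-onto , z∈D , z-att) y∉D y-att =
    z′ , z′-inj , z′-onto , z′∈D′ , z′-att
    where
    z′ : Fin (suc m) → V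
    z′ = insertAt z (fromℕ m) y

    z′-last : z′ (fromℕ m) ≡ y
    z′-last = insertAt-lookup z (fromℕ m) y

    z′-inject₁ : ∀ i → z′ (inject₁ i) ≡ z i
    z′-inject₁ = insertAt-fromℕ-inject₁ z y

    z′-inject₁≢last : ∀ i → z′ (inject₁ i) ≢ z′ (fromℕ m)
    z′-inject₁≢last i eq = y∉D (subst (_∈ D) (trans (sym (z′-inject₁ i)) (trans eq z′-last)) (z∈D i))

    z′-inj : Injective _≡_ _≡_ z′
    z′-inj {i} {j} eq with view i | view j
    ... | ‵fromℕ     | ‵fromℕ     = refl
    ... | ‵inject₁ i | ‵inject₁ j = cong inject₁ (z-inj (trans (sym (z′-inject₁ i)) (trans eq (z′-inject₁ j))))
    ... | ‵fromℕ     | ‵inject₁ j = contradiction (sym eq) (z′-inject₁≢last j)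
    ... | ‵inject₁ i | ‵fromℕ     = contradiction eq (z′-inject₁≢last i)

    z′-onto : ∀ v → v ∈ D ∪ ⁅ y ⁆ → ∃ λ j → z′ j ≡ v
    z′-onto v v∈D′ with x∈p∪q⁻ D ⁅ y ⁆ v∈D′
    ... | inj₁ v∈D with z-onto v v∈D
    ...   | j , zj≡v = inject₁ j , trans (z′-inject₁ j) zj≡v
    z′-onto v v∈D′ | inj₂ v∈y = fromℕ m , trans z′-last (sym (x∈⁅y⁆⇒x≡y y v∈y))

    z′∈D′ : ∀ j → z′ j ∈ D ∪ ⁅ y ⁆
    z′∈D′ j with view j
    ... | ‵fromℕ     = subst (_∈ D ∪ ⁅ y ⁆) (sym z′-last) (q⊆p∪q D ⁅ y ⁆ (x∈⁅x⁆ y))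
    ... | ‵inject₁ j = subst (_∈ D ∪ ⁅ y ⁆) (sym (z′-inject₁ j)) (p⊆p∪q ⁅ y ⁆ (z∈D j))

    z′-att : ∀ j → AttractsP H (λ v → v ∈ Y ⊎ ∃ λ i → i <ᶠ j × z′ i ≡ v) (z′ j)
    z′-att j with view j
    ... | ‵fromℕ = subst (AttractsP H _) (sym z′-last) (AttractsP-mono earlier y-att)
      where
      earlier : ∀ {v} → v ∈ Y ∪ D → v ∈ Y ⊎ ∃ λ i → i <ᶠ fromℕ m × z′ i ≡ v
      earlier {v} v∈Y∪D with x∈p∪q⁻ Y D v∈Y∪D
      ... | inj₁ v∈Y = inj₁ v∈Y
      ... | inj₂ v∈D with z-onto v v∈D
      ...   | i , zi≡v = inj₂ (inject₁ i , inject₁<fromℕ i , trans (z′-inject₁ i) zi≡v)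
    ... | ‵inject₁ j = subst (AttractsP H _) (sym (z′-inject₁ j)) (AttractsP-mono earlier (z-att j))
      where
      earlier : ∀ {v} → (v ∈ Y ⊎ ∃ λ i → i <ᶠ j × z i ≡ v) →
                v ∈ Y ⊎ ∃ λ i → i <ᶠ inject₁ j × z′ i ≡ v
      earlier (inj₁ v∈Y)              = inj₁ v∈Y
      earlier (inj₂ (i , i<j , zi≡v)) =
        inj₂ (inject₁ i , inject₁-mono-< i<j , trans (z′-inject₁ i) zi≡v)

module Saturation (H : Hypergraph) (k : ℕ) (1≤k : 1 ≤ k) (meager : Meager H (2 * k))
  (Y : Subset (n H)) (∣Y∣≤k : ∣ Y ∣ ≤ k) (C : Subset (n H)) (closure : IsClosure H Y C) where

  record Growth (m : ℕ) : Set where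
    field
      D        : Subset (n H)
      ∣D∣≡m    : ∣ D ∣ ≡ m
      D⊆C─Y    : D ⊆ C ─ Y
      m≤edges  : m ≤ edgesIn H (Y ∪ D)
      ordering : AttractionOrdering H Y D m

  open Growth public

  private
    Y⊆C : Y ⊆ C
    Y⊆C = proj₁ closure

    C-closed : Closed H C
    C-closed = proj₁ (proj₂ closure)

    C-least : ∀ X → Y ⊆ X → Closed H X → C ⊆ X
    C-least = proj₂ (proj₂ closure)

  start : Growth 0
  start = record
    { D = ⊥ ; ∣D∣≡m = ∣⊥∣≡0 (n H) ; D⊆C─Y = λ v∈⊥ → contradiction v∈⊥ ∉⊥
    ; m≤edges = z≤n ; ordering = emptyOrdering H }

  Y∪D⊆C : ∀ {m} (g : Growth m) → Y ∪ D g ⊆ C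
  Y∪D⊆C g v∈Y∪D with x∈p∪q⁻ Y (D g) v∈Y∪D
  ... | inj₁ v∈Y = Y⊆C v∈Y
  ... | inj₂ v∈D = p─q⊆p C Y (D⊆C─Y g v∈D)

  grow : ∀ {m} (g : Growth m) {y} → y ∉ Y ∪ D g → Attracts H (Y ∪ D g) y → Growth (suc m)
  grow {m} g {y} y∉Y∪D y-att = record
    { D = D g ∪ ⁅ y ⁆
    ; ∣D∣≡m = trans (x∉p⇒∣p∪⁅x⁆∣≡1+∣p∣ y∉D) (cong suc (∣D∣≡m g))
    ; D⊆C─Y = D′⊆C─Y
    ; m≤edges = ≤-<-trans (m≤edges g) edges-grow
    ; ordering = extendOrdering H (ordering g) y∉D y-att }
    where
    y∉D : y ∉ D g
    y∉D = y∉Y∪D ∘ q⊆p∪q Y (D g)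

    edges-grow : edgesIn H (Y ∪ D g) < edgesIn H (Y ∪ (D g ∪ ⁅ y ⁆))
    edges-grow = subst (edgesIn H (Y ∪ D g) <_) (cong (edgesIn H) (∪-assoc Y (D g) ⁅ y ⁆))
                       (edgesIn-<-∪⁅⁆ H y∉Y∪D y-att)

    D′⊆C─Y : D g ∪ ⁅ y ⁆ ⊆ C ─ Y
    D′⊆C─Y v∈D′ with x∈p∪q⁻ (D g) ⁅ y ⁆ v∈D′
    ... | inj₁ v∈D = D⊆C─Y g v∈D
    ... | inj₂ v∈y rewrite x∈⁅y⁆⇒x≡y y v∈y =
      x∈p∧x∉q⇒x∈p─q (C-closed y (AttractsP-mono H (Y∪D⊆C g) y-att)) (y∉Y∪D ∘ p⊆p∪q (D g))

  ¬Growth-k : ¬ Growth k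
  ¬Growth-k g =
    meager (Y ∪ D g) (≤-trans ∣Y∪D∣≤2k (*-monoʳ-≤ 2 (m≤n*m k 2))) (Y∪D-nonempty , dense)
    where
    ∣Y∪D∣≤2k : ∣ Y ∪ D g ∣ ≤ 2 * k
    ∣Y∪D∣≤2k = begin
      ∣ Y ∪ D g ∣      ≤⟨ ∣p∪q∣≤∣p∣+∣q∣ Y (D g) ⟩
      ∣ Y ∣ + ∣ D g ∣  ≤⟨ +-mono-≤ ∣Y∣≤k (≤-reflexive (∣D∣≡m g)) ⟩
      k + k           ≡⟨ cong (k +_) (+-identityʳ k) ⟨
      2 * k           ∎
      where open ≤-Reasoning

    dense : ∣ Y ∪ D g ∣ ≤ 2 * edgesIn H (Y ∪ D g)
    dense = ≤-trans ∣Y∪D∣≤2k (*-monoʳ-≤ 2 (m≤edges g))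

    Y∪D-nonempty : Nonempty (Y ∪ D g)
    Y∪D-nonempty with ordering g
    ... | z , _ , _ , z∈D , _ = z (fromℕ< 1≤k) , q⊆p∪q Y (D g) (z∈D (fromℕ< 1≤k))

  saturate : ∀ f {m} → f + m ≡ k → Growth m →
             ∃ λ m → m < k × Σ (Growth m) λ g → Closed H (Y ∪ D g)
  saturate zero refl g = contradiction g ¬Growth-k
  saturate (suc f) {m} 1+f+m≡k g with closed⊎attractsOutside H (Y ∪ D g)
  ... | inj₁ closed            = m , subst (m <_) 1+f+m≡k (s≤s (m≤n+m m f)) , g , closed
  ... | inj₂ (y , y∉ , y-att) = saturate f (trans (+-suc f m) 1+f+m≡k) (grow g y∉ y-att)

  closed⇒D≡C─Y : ∀ {m} (g : Growth m) → Closed H (Y ∪ D g) → D g ≡ C ─ Y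
  closed⇒D≡C─Y g closed = ⊆-antisym (D⊆C─Y g) C─Y⊆D
    where
    C⊆Y∪D : C ⊆ Y ∪ D g
    C⊆Y∪D = C-least (Y ∪ D g) (p⊆p∪q (D g)) closed

    C─Y⊆D : C ─ Y ⊆ D g
    C─Y⊆D v∈C─Y with x∈p∪q⁻ Y (D g) (C⊆Y∪D (p─q⊆p C Y v∈C─Y))
    ... | inj₁ v∈Y = contradiction v∈Y (x∈p─q⇒x∉q v∈C─Y)
    ... | inj₂ v∈D = v∈D

lemma2p4p2 : (k : ℕ) → 1 ≤ k → (H : Hypergraph) → Meager H (2 * k) →
    (Y : Subset (n H)) → ∣ Y ∣ ≤ k →
    (C : Subset (n H)) → IsClosure H Y C →
    ∣ C ─ Y ∣ < k ×
    Σ (Fin ∣ C ─ Y ∣ → Fin (n H)) λ z →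
      Injective _≡_ _≡_ z ×
      (∀ v → v ∈ C ─ Y → ∃ λ j → z j ≡ v) ×
      (∀ j → z j ∈ C ─ Y) ×
      (∀ j → AttractsP H (λ v → v ∈ Y ⊎ ∃ λ i → i <ᶠ j × z i ≡ v) (z j))
lemma2p4p2 k 1≤k H meager Y ∣Y∣≤k C closure =
  let open Saturation H k 1≤k meager Y ∣Y∣≤k C closure
      (m , m<k , g , closed) = saturate k (+-identityʳ k) start
      D≡C─Y = closed⇒D≡C─Y g closed
      ∣C─Y∣≡m = trans (cong ∣_∣ (sym D≡C─Y)) (∣D∣≡m g)
  in subst (_< k) (sym ∣C─Y∣≡m) m<k ,
     subst (AttractionOrdering H Y (C ─ Y)) (sym ∣C─Y∣≡m)
       (subst (λ D → AttractionOrdering H Y D m) D≡C─Y (ordering g))
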